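{- Let $\mathbbm{k}$ be an algebraically closed field of characteristic zero and $\mathbb{D}_\infty=\langle g,x\mid x^2=1,\ xgx=g^{ -1}\rangle$. Let $f_{i,j}\in(\mathbbm{k}\mathbb{D}_\infty)^*$ ($i\in\mathbb{Z}$, $j\in\{0,1\}$) be defined by $f_{i,j}(g^{i'}x^{j'})=\delta_{i,i'}\delta_{j,j'}$, and let $$E=\sum_{i\in\mathbb{Z}} i(f_{i,0}+f_{i,1}),\quad \Phi_\lambda=\sum_{i\in\mathbb{Z}}\lambda^i(f_{i,0}+f_{i,1}),\quad \Psi_\lambda=\sum_{i\in\mathbb{Z}}\lambda^i(f_{i,0}-f_{i,1})\quad(\lambda\in\mathbbm{k}^*).$$ Let $A$ be the subalgebra of the finite dual $(\mathbbm{k}\mathbb{D}_\infty)^\circ$ generated by $E$, $\Phi_\lambda$, $\Psi_\lambda$ ($\lambda\in\mathbbm{k}^*$). Then $A$ is a Hopf subalgebra of $(\mathbbm{k}\mathbb{D}_\infty)^\circ$, and $$\Delta(E)=E\otimes1+\Psi_1\otimes E,\quad \Delta(\Phi_\lambda)=\tfrac12(\Phi_\lambda+\Psi_\lambda)\otimes\Phi_\lambda+\tfrac12(\Phi_\lambda-\Psi_\lambda)\otimes\Phi_{\lambda^{ -1}},$$ $$\Delta(\Psi_\lambda)=\tfrac12(\Phi_\lambda+\Psi_\lambda)\otimes\Psi_\lambda-\tfrac12(\Phi_\lambda-\Psi_\lambda)\otimes\Psi_{\lambda^{ -1}},\quad \varepsilon(\Phi_\lambda)=\varepsilon(\Psi_\lambda)=1,\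 \varepsilon(E)=0,$$ $$S(\Phi_\lambda)=\tfrac12(\Phi_{\lambda^{ -1}}+\Psi_{\lambda^{ -1}})+\tfrac12(\Phi_\lambda-\Psi_\lambda),\quad S(\Psi_\lambda)=\tfrac12(\Phi_{\lambda^{ -1}}+\Psi_{\lambda^{ -1}})-\tfrac12(\Phi_\lambda-\Psi_\lambda),\quad S(E)=-\Psi_1E.$$
   Context: The finite dual $H^\circ$ of a Hopf algebra $H$ is the Hopf algebra of all $f\in H^*$ vanishing on some two-sided ideal of finite codimension, with structure maps dual to those of $H$; $\mathbbm{k}\mathbb{D}_\infty$ carries its group-algebra Hopf structure. Infinite sums such as $\sum_i c_i f_{i,j}$ denote the functional taking value $c_i$ on $g^ix^j$. -}

module Defs where

open import Level using (_⊔_) renaming (suc to lsuc)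
open import Algebra.Bundles using (CommutativeRing)
open import Data.Nat using (ℕ; zero; suc)
open import Data.Integer using (ℤ; +_; -[1+_]) renaming (_+_ to _+ℤ_; -_ to -ℤ_)
open import Data.Bool using (Bool; true; false; _xor_)
open import Data.Product using (Σ; ∃; _×_; _,_; proj₁; proj₂)
open import Data.Fin using (Fin)
open import Data.List.Relation.Unary.All using (All)
open import Data.List using (List; []; _∷_; _++_; map; foldr; concat; tabulate)
open import Relation.Nullary using (¬_)

-- The infinite dihedral group D∞ = ⟨ g , x | x² = 1 , x g x = g⁻¹ ⟩,
-- realised by its normal form: the pair (i , j) stands for g^i x^j,
-- with j = false meaning x⁰ and j = true meaning x¹.

D∞ : Set
D∞ = ℤ × Bool

-- (g^i x^j)(g^k x^l) = g^(i + (-1)^j k) x^(j + l)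
_·_ : D∞ → D∞ → D∞
(i , false) · (k , l) = (i +ℤ k , l)
(i , true)  · (k , l) = (i +ℤ (-ℤ k) , true xor l)

e : D∞
e = (+ 0 , false)

inv : D∞ → D∞
inv (i , false) = (-ℤ i , false)
inv (i , true)  = (i , true)

module WithRing {c ℓ} (R : CommutativeRing c ℓ) where
  open CommutativeRing R public renaming (Carrier to K)

  record IsField : Set (c ⊔ ℓ) where
    field
      0≉1 : ¬ (0# ≈ 1#)
      inverse : ∀ x → ¬ (x ≈ 0#) → ∃ λ y → x * y ≈ 1#

  natK : ℕ → K
  natK zero    = 0#
  natK (suc n) = 1# + natK n

  intK : ℤ → K
  intK (+ n)      = natK n
  intK -[1+ n ]   = - natK (suc n)

  CharZero : Set ℓ
  CharZero = ∀ n → ¬ (natK (suc n) ≈ 0#)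

  -- polynomials as coefficient lists a₀ ∷ a₁ ∷ … (lowest degree first)
  evalPoly : List K → K → K
  evalPoly []       _ = 0#
  evalPoly (a ∷ as) z = a + z * evalPoly as z

  AlgClosed : Set (c ⊔ ℓ)
  AlgClosed = ∀ (a : K) (as : List K) (aₙ : K) → ¬ (aₙ ≈ 0#) →
              ∃ λ z → evalPoly (a ∷ as ++ (aₙ ∷ [])) z ≈ 0#

  _^_ : K → ℕ → K
  z ^ zero  = 1#
  z ^ suc n = z * (z ^ n)

  -- an element λ ∈ K* together with its inverse
  Unit : Set (c ⊔ ℓ)
  Unit = Σ (K × K) λ { (l , m) → l * m ≈ 1# }

  val : Unit → K
  val ((l , _) , _) = l

  unitInv : Unit → Unit
  unitInv ((l , m) , p) = (m , l) , trans (*-comm m l) p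

  oneU : Unit
  oneU = (1# , 1#) , *-identityˡ 1#

  zpow : Unit → ℤ → K
  zpow ((l , m) , _) (+ n)    = l ^ n
  zpow ((l , m) , _) -[1+ n ] = m ^ suc n

  sign : Bool → K
  sign false = 1#
  sign true  = - 1#

  -- The full dual (k D∞)* : a linear functional on the group algebra is
  -- determined by its values on the basis D∞.

  Fun : Set c
  Fun = D∞ → K

  _≐_ : Fun → Fun → Set ℓ
  f ≐ h = ∀ a → f a ≈ h a

  -- The functionals of the statement, given by their values on g^i x^j:
  -- E = Σ i (f_{i,0} + f_{i,1}),  Φ_λ = Σ λ^i (f_{i,0} + f_{i,1}),
  -- Ψ_λ = Σ λ^i (f_{i,0} - f_{i,1}).
  E : Fun
  E (i , _) = intK i

  Φ : Unit → Fun
  Φ l (i , _) = zpow l i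

  Ψ : Unit → Fun
  Ψ l (i , j) = zpow l i * sign j

  -- Hopf structure of the dual, dual to that of k D∞
  -- (Δ g = g ⊗ g, ε g = 1, S g = g⁻¹).

  -- product and unit (dual to Δ and ε of k D∞)
  _⋆_ : Fun → Fun → Fun
  (f ⋆ h) a = f a * h a

  𝟙 : Fun
  𝟙 _ = 1#

  _⊕_ : Fun → Fun → Fun
  (f ⊕ h) a = f a + h a

  _⊙_ : K → Fun → Fun
  (k ⊙ f) a = k * f a

  _⊖_ : Fun → Fun → Fun
  (f ⊖ h) a = f a - h a

  ⊝_ : Fun → Fun
  (⊝ f) a = - f a

  -- elements of (k D∞ ⊗ k D∞)* ≅ functions on D∞ × D∞
  Fun₂ : Set c
  Fun₂ = D∞ → D∞ → K

  _⊗_ : Fun → Fun → Fun₂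
  (f ⊗ h) a b = f a * h b

  _⊕₂_ : Fun₂ → Fun₂ → Fun₂
  (F ⊕₂ G) a b = F a b + G a b

  _≐₂_ : Fun₂ → Fun₂ → Set ℓ
  F ≐₂ G = ∀ a b → F a b ≈ G a b

  Δ : Fun → Fun₂
  Δ f a b = f (a · b)

  ε : Fun → K
  ε f = f e

  S : Fun → Fun
  S f a = f (inv a)

  -- The group algebra k D∞: finite formal combinations Σ cₖ aₖ.

  KG : Set c
  KG = List (K × D∞)

  ⟪_⟫ : Fun → KG → K
  ⟪ f ⟫ u = foldr (λ { (k , a) r → k * f a + r }) 0# u

  scaleKG : K → KG → KG
  scaleKG k = map (λ { (c′ , a) → (k * c′ , a) })

  lmulKG : D∞ → KG → KG
  lmulKG b = map (λ { (c′ , a) → (c′ , b · a) })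

  rmulKG : D∞ → KG → KG
  rmulKG b = map (λ { (c′ , a) → (c′ , a · b) })

  lincomb : ∀ {n} → (Fin n → K) → (Fin n → KG) → KG
  lincomb cs bs = concat (tabulate (λ k → scaleKG (cs k) (bs k)))

  -- a two-sided ideal of k D∞ (closed under +, scalars, and left/right
  -- multiplication by the basis elements, hence by all of k D∞)
  record IsIdeal (I : KG → Set (c ⊔ ℓ)) : Set (c ⊔ ℓ) where
    field
      +-closed : ∀ u v → I u → I v → I (u ++ v)
      scale-closed : ∀ k u → I u → I (scaleKG k u)
      lmul-closed : ∀ b u → I u → I (lmulKG b u)
      rmul-closed : ∀ b u → I u → I (rmulKG b u)

  -- finite codimension: finitely many b₀ … b_{n-1} span k D∞ modulo I
  FinCodim : (KG → Set (c ⊔ ℓ)) → Set (c ⊔ ℓ)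
  FinCodim I = Σ ℕ λ n → Σ (Fin n → KG) λ bs →
               ∀ u → Σ (Fin n → K) λ cs → I (u ++ scaleKG (- 1#) (lincomb cs bs))

  InFiniteDual : Fun → Set (lsuc (c ⊔ ℓ))
  InFiniteDual f = Σ (KG → Set (c ⊔ ℓ)) λ I →
                   IsIdeal I × FinCodim I × (∀ u → I u → ⟪ f ⟫ u ≈ 0#)

  data InA : Fun → Set (c ⊔ ℓ) where
    genE  : InA E
    genΦ  : ∀ l → InA (Φ l)
    genΨ  : ∀ l → InA (Ψ l)
    unit  : InA 𝟙
    add   : ∀ {f h} → InA f → InA h → InA (f ⊕ h)
    scal  : ∀ k {f} → InA f → InA (k ⊙ f)
    mul   : ∀ {f h} → InA f → InA h → InA (f ⋆ h)
    resp  : ∀ {f h} → f ≐ h → InA f → InA h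

  -- A ⊗ A, viewed inside (k D∞ ⊗ k D∞)* via f ⊗ h ↦ ((a , b) ↦ f a h b)
  sum₂ : List (Fun × Fun) → Fun₂
  sum₂ []             a b = 0#
  sum₂ ((f , h) ∷ ps) a b = f a * h b + sum₂ ps a b

  InA⊗A : Fun₂ → Set (c ⊔ ℓ)
  InA⊗A F = Σ (List (Fun × Fun)) λ ps →
            All (λ p → InA (proj₁ p) × InA (proj₂ p)) ps × (F ≐₂ sum₂ ps)

module Submission where

-- A functional on k D∞ is a function D∞ → K and the operations of the dual are
-- given pointwise through the group law, so the formulas for Δ, ε and S on the
-- generators are identities between functions of g^i x^j.  They follow from the
-- exponent law λ^(i+k) = λ^i λ^k, the additivity of ℤ → K and ring normalisation.
-- Closure of A under S and Δ is then an induction on the generation of A, since S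
-- is an algebra map and Δ is multiplicative.
--
-- The substantial part is that A lies in the finite dual.  For f ∈ A and each j,
-- the sequence i ↦ f (g^i x^j) is annihilated by a product ∏ (T - μ) of shifted
-- differences: this holds for the generators and survives sums, scalars and
-- products.  It then holds for every two-sided translate d ↦ f (a d b) as well,
-- once the inverses of the roots μ are added.  A sequence annihilated by an
-- operator of order D is a fixed linear combination of its values at 0 … D-1, so
-- modulo the two-sided ideal I = { u | every translate of f vanishes on u } each
-- g^i x^j is a combination of the 2D elements g^n x^j (n < D), and f vanishes on I.
--
-- The
-- field and characteristic-zero hypotheses only provide ½.

open import Defs
open import Level using (Lift; lift)
open import Algebra.Bundles using (CommutativeRing)
open import Data.Product using (Σ; _×_; _,_; proj₁; proj₂)
open import Data.Nat as ℕ using (ℕ; zero; suc)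
import Data.Nat.Properties as ℕP
open import Data.Integer as ℤ using (ℤ; +_; -[1+_])
import Data.Integer.Properties as ℤP
import Data.Integer.Solver as ℤSolver
open import Data.Bool using (Bool; true; false; _xor_)
open import Data.List as List using (List; []; _∷_; _++_)
open import Data.List.Relation.Unary.All using (All; []; _∷_)
open import Data.Vec as Vec using (Vec; []; _∷_)
open import Data.Maybe using (Maybe; just; nothing)
open import Relation.Nullary using (¬_; yes; no)
open import Relation.Binary.PropositionalEquality as ≡ using (_≡_)
import Algebra.Solver.Ring.AlmostCommutativeRing as ACR
import Algebra.Properties.Ring as RingProperties
import Algebra.Properties.Semiring.Mult.TCOptimised as Multiples
import Relation.Binary.Reasoning.Setoid as SetoidReasoning

module HopfSubalgebra {c ℓ} (R : CommutativeRing c ℓ) where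
  open WithRing R
  open RingProperties ring
    using (-‿distribˡ-*; -‿distribʳ-*; -‿involutive; -‿+-comm; -0#≈0#; -1*x≈-x)
  open Multiples semiring using (1+×; ×-homo-+; ×1-homo-*) renaming (_×_ to _×′_)
  open SetoidReasoning setoid
  module ℤS = ℤSolver.+-*-Solver

  -- The ring map ℤ → K and the ring solver with integer coefficients

  -- The canonical map ℤ → K, built from the library's optimised natural
  -- multiples so that 1 ↦ 1# holds definitionally, as the solver requires.
  ι : ℤ → K
  ι (+ n)    = n ×′ 1#
  ι -[1+ n ] = - (suc n ×′ 1#)

  cancel-1 : ∀ a b → (1# + a) - (1# + b) ≈ a - b
  cancel-1 a b = begin
    (1# + a) + - (1# + b)     ≈⟨ +-cong refl (sym (-‿+-comm 1# b)) ⟩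
    (1# + a) + (- 1# + - b)   ≈⟨ +-assoc _ _ _ ⟩
    1# + (a + (- 1# + - b))   ≈⟨ +-cong refl (sym (+-assoc _ _ _)) ⟩
    1# + ((a + - 1#) + - b)   ≈⟨ +-cong refl (+-cong (+-comm _ _) refl) ⟩
    1# + ((- 1# + a) + - b)   ≈⟨ +-cong refl (+-assoc _ _ _) ⟩
    1# + (- 1# + (a + - b))   ≈⟨ sym (+-assoc _ _ _) ⟩
    (1# + - 1#) + (a + - b)   ≈⟨ +-cong (-‿inverseʳ _) refl ⟩
    0# + (a + - b)            ≈⟨ +-identityˡ _ ⟩
    a + - b                   ∎

  ι-⊖ : ∀ m n → ι (m ℤ.⊖ n) ≈ m ×′ 1# - n ×′ 1#
  ι-⊖ m       zero    = sym (trans (+-cong refl -0#≈0#) (+-identityʳ _))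
  ι-⊖ zero    (suc n) = sym (+-identityˡ _)
  ι-⊖ (suc m) (suc n) = begin
    ι (suc m ℤ.⊖ suc n)                 ≡⟨ ≡.cong ι (ℤP.[1+m]⊖[1+n]≡m⊖n m n) ⟩
    ι (m ℤ.⊖ n)                         ≈⟨ ι-⊖ m n ⟩
    m ×′ 1# - n ×′ 1#                   ≈⟨ sym (cancel-1 _ _) ⟩
    (1# + m ×′ 1#) - (1# + n ×′ 1#)     ≈⟨ sym (+-cong (1+× m 1#) (-‿cong (1+× n 1#))) ⟩
    suc m ×′ 1# - suc n ×′ 1#           ∎

  ι-+ : ∀ i j → ι (i ℤ.+ j) ≈ ι i + ι j
  ι-+ (+ m)    (+ n)    = ×-homo-+ 1# m n
  ι-+ (+ m)    -[1+ n ] = ι-⊖ m (suc n)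
  ι-+ -[1+ m ] (+ n)    = trans (ι-⊖ n (suc m)) (+-comm _ _)
  ι-+ -[1+ m ] -[1+ n ] = begin
    - (suc (suc (m ℕ.+ n)) ×′ 1#)       ≡⟨ ≡.cong (λ k → - (suc k ×′ 1#)) (≡.sym (ℕP.+-suc m n)) ⟩
    - ((suc m ℕ.+ suc n) ×′ 1#)         ≈⟨ -‿cong (×-homo-+ 1# (suc m) (suc n)) ⟩
    - (suc m ×′ 1# + suc n ×′ 1#)       ≈⟨ sym (-‿+-comm _ _) ⟩
    - (suc m ×′ 1#) + - (suc n ×′ 1#)   ∎

  ι-neg : ∀ i → ι (ℤ.- i) ≈ - ι i
  ι-neg (+ zero)  = sym -0#≈0#
  ι-neg (+ suc n) = refl
  ι-neg -[1+ n ]  = sym (-‿involutive _)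

  ι-* : ∀ i j → ι (i ℤ.* j) ≈ ι i * ι j
  ι-* (+ m) (+ n) = trans (reflexive (≡.cong ι (≡.sym (ℤP.pos-* m n)))) (×1-homo-* m n)
  ι-* -[1+ m ] (+ n) = begin
    ι (-[1+ m ] ℤ.* + n)            ≡⟨ ≡.cong ι (≡.sym (ℤP.neg-distribˡ-* (+ suc m) (+ n))) ⟩
    ι (ℤ.- (+ suc m ℤ.* + n))       ≈⟨ ι-neg (+ suc m ℤ.* + n) ⟩
    - ι (+ suc m ℤ.* + n)           ≈⟨ -‿cong (ι-* (+ suc m) (+ n)) ⟩
    - (ι (+ suc m) * ι (+ n))       ≈⟨ -‿distribˡ-* _ _ ⟩
    ι -[1+ m ] * ι (+ n)            ∎
  ι-* (+ m) -[1+ n ] = begin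
    ι (+ m ℤ.* -[1+ n ])            ≡⟨ ≡.cong ι (≡.sym (ℤP.neg-distribʳ-* (+ m) (+ suc n))) ⟩
    ι (ℤ.- (+ m ℤ.* + suc n))       ≈⟨ ι-neg (+ m ℤ.* + suc n) ⟩
    - ι (+ m ℤ.* + suc n)           ≈⟨ -‿cong (ι-* (+ m) (+ suc n)) ⟩
    - (ι (+ m) * ι (+ suc n))       ≈⟨ -‿distribʳ-* _ _ ⟩
    ι (+ m) * ι -[1+ n ]            ∎
  ι-* -[1+ m ] -[1+ n ] = begin
    (suc m ℕ.* suc n) ×′ 1#             ≈⟨ ×1-homo-* (suc m) (suc n) ⟩
    ι (+ suc m) * ι (+ suc n)           ≈⟨ sym (-‿involutive _) ⟩
    - - (ι (+ suc m) * ι (+ suc n))     ≈⟨ -‿cong (-‿distribʳ-* _ _) ⟩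
    - (ι (+ suc m) * ι -[1+ n ])        ≈⟨ -‿distribˡ-* _ _ ⟩
    ι -[1+ m ] * ι -[1+ n ]             ∎

  ι-homomorphism : ACR._-Raw-AlmostCommutative⟶_ ℤ.+-*-rawRing (ACR.fromCommutativeRing R)
  ι-homomorphism = record
    { ⟦_⟧ = ι ; +-homo = ι-+ ; *-homo = ι-* ; -‿homo = ι-neg ; 0-homo = refl ; 1-homo = refl }

  ι-≟ : ∀ i j → Maybe (ι i ≈ ι j)
  ι-≟ i j with i ℤ.≟ j
  ... | yes ≡.refl = just refl
  ... | no _       = nothing

  open import Algebra.Solver.Ring ℤ.+-*-rawRing (ACR.fromCommutativeRing R) ι-homomorphism ι-≟
    using (solve; _:=_; _:+_; _:*_; :-_; _:-_; con)

  natK≈ι : ∀ n → natK n ≈ ι (+ n)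
  natK≈ι zero    = refl
  natK≈ι (suc n) = trans (+-cong refl (natK≈ι n)) (sym (1+× n 1#))

  intK≈ι : ∀ i → intK i ≈ ι i
  intK≈ι (+ n)    = natK≈ι n
  intK≈ι -[1+ n ] = -‿cong (natK≈ι (suc n))

  intK-+ : ∀ i j → intK (i ℤ.+ j) ≈ intK i + intK j
  intK-+ i j = trans (intK≈ι (i ℤ.+ j)) (trans (ι-+ i j) (sym (+-cong (intK≈ι i) (intK≈ι j))))

  intK-neg : ∀ i → intK (ℤ.- i) ≈ - intK i
  intK-neg i = trans (intK≈ι (ℤ.- i)) (trans (ι-neg i) (sym (-‿cong (intK≈ι i))))

  -- Integer powers of units

  val⁻¹ : Unit → K
  val⁻¹ μ = val (unitInv μ)

  val⁻¹*val : ∀ μ → val⁻¹ μ * val μ ≈ 1#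
  val⁻¹*val μ = proj₂ (unitInv μ)

  1^n : ∀ n → 1# ^ n ≈ 1#
  1^n zero    = refl
  1^n (suc n) = trans (*-identityˡ _) (1^n n)

  zpow-oneU : ∀ i → zpow oneU i ≈ 1#
  zpow-oneU (+ n)    = 1^n n
  zpow-oneU -[1+ n ] = 1^n (suc n)

  zpow-suc : ∀ μ i → zpow μ (ℤ.suc i) ≈ val μ * zpow μ i
  zpow-suc μ               (+ n)          = refl
  zpow-suc ((a , b) , ab≈1) -[1+ zero ]    = sym (trans (*-cong refl (*-identityʳ b)) ab≈1)
  zpow-suc ((a , b) , ab≈1) -[1+ suc n ]   = sym (begin
    a * (b * (b * (b ^ n)))   ≈⟨ sym (*-assoc _ _ _) ⟩
    (a * b) * (b * (b ^ n))   ≈⟨ *-cong ab≈1 refl ⟩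
    1# * (b * (b ^ n))        ≈⟨ *-identityˡ _ ⟩
    b * (b ^ n)               ∎)

  zpow-pred : ∀ μ i → zpow μ (ℤ.pred i) ≈ val⁻¹ μ * zpow μ i
  zpow-pred μ i = sym (begin
    val⁻¹ μ * zpow μ i                            ≡⟨ ≡.cong (λ k → val⁻¹ μ * zpow μ k) (≡.sym (ℤP.suc-pred i)) ⟩
    val⁻¹ μ * zpow μ (ℤ.suc (ℤ.pred i))           ≈⟨ *-cong refl (zpow-suc μ (ℤ.pred i)) ⟩
    val⁻¹ μ * (val μ * zpow μ (ℤ.pred i))         ≈⟨ sym (*-assoc _ _ _) ⟩
    (val⁻¹ μ * val μ) * zpow μ (ℤ.pred i)         ≈⟨ *-cong (val⁻¹*val μ) refl ⟩
    1# * zpow μ (ℤ.pred i)                        ≈⟨ *-identityˡ _ ⟩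
    zpow μ (ℤ.pred i)                             ∎)

  +-exchangeℤ : ∀ i k j → i ℤ.+ (k ℤ.+ j) ≡ k ℤ.+ (i ℤ.+ j)
  +-exchangeℤ = ℤS.solve 3 (λ i k j → i ℤS.:+ (k ℤS.:+ j) ℤS.:= k ℤS.:+ (i ℤS.:+ j)) ≡.refl

  zpow-+ : ∀ μ i j → zpow μ (i ℤ.+ j) ≈ zpow μ i * zpow μ j
  zpow-+ μ i (+ zero) = trans (reflexive (≡.cong (zpow μ) (ℤP.+-identityʳ i))) (sym (*-identityʳ _))
  zpow-+ μ i (+ suc n) = begin
    zpow μ (i ℤ.+ ℤ.suc (+ n))          ≡⟨ ≡.cong (zpow μ) (+-exchangeℤ i (+ 1) (+ n)) ⟩
    zpow μ (ℤ.suc (i ℤ.+ + n))          ≈⟨ zpow-suc μ (i ℤ.+ + n) ⟩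
    val μ * zpow μ (i ℤ.+ + n)          ≈⟨ *-cong refl (zpow-+ μ i (+ n)) ⟩
    val μ * (zpow μ i * zpow μ (+ n))   ≈⟨ solve 3 (λ a x y → a :* (x :* y) := x :* (a :* y)) refl (val μ) _ _ ⟩
    zpow μ i * zpow μ (+ suc n)         ∎
  zpow-+ μ i -[1+ zero ] = begin
    zpow μ (i ℤ.+ -[1+ 0 ])   ≡⟨ ≡.cong (zpow μ) (ℤP.+-comm i _) ⟩
    zpow μ (ℤ.pred i)         ≈⟨ zpow-pred μ i ⟩
    val⁻¹ μ * zpow μ i        ≈⟨ solve 2 (λ a x → a :* x := x :* (a :* con (+ 1))) refl (val⁻¹ μ) _ ⟩
    zpow μ i * zpow μ -[1+ 0 ] ∎
  zpow-+ μ i -[1+ suc n ] = begin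
    zpow μ (i ℤ.+ ℤ.pred -[1+ n ])             ≡⟨ ≡.cong (zpow μ) (+-exchangeℤ i -[1+ 0 ] -[1+ n ]) ⟩
    zpow μ (ℤ.pred (i ℤ.+ -[1+ n ]))           ≈⟨ zpow-pred μ (i ℤ.+ -[1+ n ]) ⟩
    val⁻¹ μ * zpow μ (i ℤ.+ -[1+ n ])          ≈⟨ *-cong refl (zpow-+ μ i -[1+ n ]) ⟩
    val⁻¹ μ * (zpow μ i * zpow μ -[1+ n ])     ≈⟨ solve 3 (λ a x y → a :* (x :* y) := x :* (a :* y)) refl (val⁻¹ μ) _ _ ⟩
    zpow μ i * zpow μ -[1+ suc n ]             ∎

  zpow-neg : ∀ μ k → zpow μ (ℤ.- k) ≡ zpow (unitInv μ) k
  zpow-neg μ (+ zero)  = ≡.refl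
  zpow-neg μ (+ suc n) = ≡.refl
  zpow-neg μ -[1+ n ]  = ≡.refl

  sign-xor : ∀ q → sign (true xor q) ≈ - sign q
  sign-xor false = refl
  sign-xor true  = sym (-‿involutive _)

  -- Coproduct, counit and antipode on the generators

  Δ-E : Δ E ≐₂ ((E ⊗ 𝟙) ⊕₂ (Ψ oneU ⊗ E))
  Δ-E (i , false) (k , q) = trans (intK-+ i k) (sym (trans
    (+-cong refl (*-cong (*-cong (zpow-oneU i) refl) refl))
    (solve 2 (λ x y → x :* con (+ 1) :+ (con (+ 1) :* con (+ 1)) :* y := x :+ y) refl (intK i) (intK k))))
  Δ-E (i , true) (k , q) = trans (intK-+ i (ℤ.- k)) (trans (+-cong refl (intK-neg k)) (sym (trans
    (+-cong refl (*-cong (*-cong (zpow-oneU i) refl) refl))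
    (solve 2 (λ x y → x :* con (+ 1) :+ (con (+ 1) :* con -[1+ 0 ]) :* y := x :+ :- y) refl (intK i) (intK k)))))

  ε-E : ε E ≈ 0#
  ε-E = refl

  ε-Φ-Ψ : ∀ μ → (ε (Φ μ) ≈ 1#) × (ε (Ψ μ) ≈ 1#)
  ε-Φ-Ψ μ = refl , *-identityʳ 1#

  S-E : S E ≐ (⊝ (Ψ oneU ⋆ E))
  S-E (i , false) = trans (intK-neg i) (sym (trans (-‿cong (*-cong (*-cong (zpow-oneU i) refl) refl))
    (solve 1 (λ x → :- ((con (+ 1) :* con (+ 1)) :* x) := :- x) refl (intK i))))
  S-E (i , true) = sym (trans (-‿cong (*-cong (*-cong (zpow-oneU i) refl) refl))
    (solve 1 (λ x → :- ((con (+ 1) :* con -[1+ 0 ]) :* x) := x) refl (intK i)))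

  module Formulas (half : K) (half-spec : half * (1# + 1#) ≈ 1#) where
    half-cancel : ∀ t → (half * (1# + 1#)) * t ≈ t
    half-cancel t = trans (*-cong half-spec refl) (*-identityˡ t)

    Δ-Φ : ∀ μ → Δ (Φ μ) ≐₂ (((half ⊙ (Φ μ ⊕ Ψ μ)) ⊗ Φ μ) ⊕₂ ((half ⊙ (Φ μ ⊖ Ψ μ)) ⊗ Φ (unitInv μ)))
    Δ-Φ μ (i , false) (k , q) = trans (zpow-+ μ i k) (sym (trans
      (solve 4 (λ h x y z → (h :* (x :+ x :* con (+ 1))) :* y :+ (h :* (x :- x :* con (+ 1))) :* z
                           := (h :* (con (+ 1) :+ con (+ 1))) :* (x :* y))
         refl half (zpow μ i) (zpow μ k) (zpow (unitInv μ) k))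
      (half-cancel _)))
    Δ-Φ μ (i , true) (k , q) = trans (zpow-+ μ i (ℤ.- k)) (trans (*-cong refl (reflexive (zpow-neg μ k))) (sym (trans
      (solve 4 (λ h x y z → (h :* (x :+ x :* con -[1+ 0 ])) :* y :+ (h :* (x :- x :* con -[1+ 0 ])) :* z
                           := (h :* (con (+ 1) :+ con (+ 1))) :* (x :* z))
         refl half (zpow μ i) (zpow μ k) (zpow (unitInv μ) k))
      (half-cancel _))))

    Δ-Ψ : ∀ μ → Δ (Ψ μ) ≐₂ (((half ⊙ (Φ μ ⊕ Ψ μ)) ⊗ Ψ μ) ⊕₂ ((⊝ (half ⊙ (Φ μ ⊖ Ψ μ))) ⊗ Ψ (unitInv μ)))
    Δ-Ψ μ (i , false) (k , q) = trans (*-cong (zpow-+ μ i k) refl) (sym (trans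
      (solve 5 (λ h x y z s → (h :* (x :+ x :* con (+ 1))) :* (y :* s) :+ (:- (h :* (x :- x :* con (+ 1)))) :* (z :* s)
                             := (h :* (con (+ 1) :+ con (+ 1))) :* ((x :* y) :* s))
         refl half (zpow μ i) (zpow μ k) (zpow (unitInv μ) k) (sign q))
      (half-cancel _)))
    Δ-Ψ μ (i , true) (k , q) =
      trans (*-cong (trans (zpow-+ μ i (ℤ.- k)) (*-cong refl (reflexive (zpow-neg μ k)))) (sign-xor q)) (sym (trans
      (solve 5 (λ h x y z s → (h :* (x :+ x :* con -[1+ 0 ])) :* (y :* s) :+ (:- (h :* (x :- x :* con -[1+ 0 ]))) :* (z :* s)
                             := (h :* (con (+ 1) :+ con (+ 1))) :* ((x :* z) :* (:- s)))
         refl half (zpow μ i) (zpow μ k) (zpow (unitInv μ) k) (sign q))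
      (half-cancel _)))

    S-Φ : ∀ μ → S (Φ μ) ≐ ((half ⊙ (Φ (unitInv μ) ⊕ Ψ (unitInv μ))) ⊕ (half ⊙ (Φ μ ⊖ Ψ μ)))
    S-Φ μ (i , false) = trans (reflexive (zpow-neg μ i)) (sym (trans
      (solve 3 (λ h w x → h :* (w :+ w :* con (+ 1)) :+ h :* (x :- x :* con (+ 1))
                         := (h :* (con (+ 1) :+ con (+ 1))) :* w)
         refl half (zpow (unitInv μ) i) (zpow μ i))
      (half-cancel _)))
    S-Φ μ (i , true) = sym (trans
      (solve 3 (λ h w x → h :* (w :+ w :* con -[1+ 0 ]) :+ h :* (x :- x :* con -[1+ 0 ])
                         := (h :* (con (+ 1) :+ con (+ 1))) :* x)
         refl half (zpow (unitInv μ) i) (zpow μ i))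
      (half-cancel _))

    S-Ψ : ∀ μ → S (Ψ μ) ≐ ((half ⊙ (Φ (unitInv μ) ⊕ Ψ (unitInv μ))) ⊖ (half ⊙ (Φ μ ⊖ Ψ μ)))
    S-Ψ μ (i , false) = trans (*-cong (reflexive (zpow-neg μ i)) refl) (sym (trans
      (solve 3 (λ h w x → h :* (w :+ w :* con (+ 1)) :- h :* (x :- x :* con (+ 1))
                         := (h :* (con (+ 1) :+ con (+ 1))) :* (w :* con (+ 1)))
         refl half (zpow (unitInv μ) i) (zpow μ i))
      (half-cancel _)))
    S-Ψ μ (i , true) = sym (trans
      (solve 3 (λ h w x → h :* (w :+ w :* con -[1+ 0 ]) :- h :* (x :- x :* con -[1+ 0 ])
                         := (h :* (con (+ 1) :+ con (+ 1))) :* (x :* con -[1+ 0 ]))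
         refl half (zpow (unitInv μ) i) (zpow μ i))
      (half-cancel _))

  -- A is closed under the antipode and the coproduct

  A-sub : ∀ {f h} → InA f → InA h → InA (f ⊖ h)
  A-sub f∈A h∈A = resp (λ _ → +-cong refl (-1*x≈-x _)) (add f∈A (scal (- 1#) h∈A))

  A-neg : ∀ {f} → InA f → InA (⊝ f)
  A-neg f∈A = resp (λ _ → -1*x≈-x _) (scal (- 1#) f∈A)

  BothInA : List (Fun × Fun) → Set (c Level.⊔ ℓ)
  BothInA = All (λ p → InA (proj₁ p) × InA (proj₂ p))

  scaleTensor : K → List (Fun × Fun) → List (Fun × Fun)
  scaleTensor k = List.map (λ { (f , h) → (k ⊙ f , h) })

  mulTensor : Fun × Fun → List (Fun × Fun) → List (Fun × Fun)
  mulTensor (f , h) = List.map (λ { (f′ , h′) → (f ⋆ f′ , h ⋆ h′) })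

  productTensor : List (Fun × Fun) → List (Fun × Fun) → List (Fun × Fun)
  productTensor []       qs = []
  productTensor (p ∷ ps) qs = mulTensor p qs ++ productTensor ps qs

  sum₂-++ : ∀ ps qs a b → sum₂ (ps ++ qs) a b ≈ sum₂ ps a b + sum₂ qs a b
  sum₂-++ []             qs a b = sym (+-identityˡ _)
  sum₂-++ ((f , h) ∷ ps) qs a b = trans (+-cong refl (sum₂-++ ps qs a b)) (sym (+-assoc _ _ _))

  sum₂-scale : ∀ k ps a b → sum₂ (scaleTensor k ps) a b ≈ k * sum₂ ps a b
  sum₂-scale k []             a b = sym (zeroʳ k)
  sum₂-scale k ((f , h) ∷ ps) a b = trans (+-cong (*-assoc _ _ _) (sum₂-scale k ps a b)) (sym (distribˡ _ _ _))

  sum₂-mul : ∀ f h qs a b → sum₂ (mulTensor (f , h) qs) a b ≈ (f a * h b) * sum₂ qs a b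
  sum₂-mul f h []               a b = sym (zeroʳ _)
  sum₂-mul f h ((f′ , h′) ∷ qs) a b = trans (+-cong
      (solve 4 (λ x y z w → (x :* z) :* (y :* w) := (x :* y) :* (z :* w)) refl (f a) (h b) (f′ a) (h′ b))
      (sum₂-mul f h qs a b)) (sym (distribˡ _ _ _))

  sum₂-product : ∀ ps qs a b → sum₂ (productTensor ps qs) a b ≈ sum₂ ps a b * sum₂ qs a b
  sum₂-product []             qs a b = sym (zeroˡ _)
  sum₂-product ((f , h) ∷ ps) qs a b = trans (sum₂-++ (mulTensor (f , h) qs) (productTensor ps qs) a b)
    (trans (+-cong (sum₂-mul f h qs a b) (sum₂-product ps qs a b)) (sym (distribʳ _ _ _)))

  BothInA-++ : ∀ {ps qs} → BothInA ps → BothInA qs → BothInA (ps ++ qs)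
  BothInA-++ []       qs∈A = qs∈A
  BothInA-++ (p ∷ ps) qs∈A = p ∷ BothInA-++ ps qs∈A

  BothInA-scale : ∀ k {ps} → BothInA ps → BothInA (scaleTensor k ps)
  BothInA-scale k []             = []
  BothInA-scale k ((f , h) ∷ ps) = (scal k f , h) ∷ BothInA-scale k ps

  BothInA-mul : ∀ {f h qs} → InA f → InA h → BothInA qs → BothInA (mulTensor (f , h) qs)
  BothInA-mul f h []               = []
  BothInA-mul f h ((f′ , h′) ∷ qs) = (mul f f′ , mul h h′) ∷ BothInA-mul f h qs

  BothInA-product : ∀ {ps qs} → BothInA ps → BothInA qs → BothInA (productTensor ps qs)
  BothInA-product []             qs = []
  BothInA-product ((f , h) ∷ ps) qs = BothInA-++ (BothInA-mul f h qs) (BothInA-product ps qs)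

  InA⊗A-add : ∀ {F G} → InA⊗A F → InA⊗A G → InA⊗A (F ⊕₂ G)
  InA⊗A-add (ps , ps∈A , F≐ps) (qs , qs∈A , G≐qs) = ps ++ qs , BothInA-++ ps∈A qs∈A ,
    λ a b → trans (+-cong (F≐ps a b) (G≐qs a b)) (sym (sum₂-++ ps qs a b))

  InA⊗A-scale : ∀ k {F} → InA⊗A F → InA⊗A (λ a b → k * F a b)
  InA⊗A-scale k (ps , ps∈A , F≐ps) = scaleTensor k ps , BothInA-scale k ps∈A ,
    λ a b → trans (*-cong refl (F≐ps a b)) (sym (sum₂-scale k ps a b))

  InA⊗A-mul : ∀ {F G} → InA⊗A F → InA⊗A G → InA⊗A (λ a b → F a b * G a b)
  InA⊗A-mul (ps , ps∈A , F≐ps) (qs , qs∈A , G≐qs) = productTensor ps qs , BothInA-product ps∈A qs∈A ,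
    λ a b → trans (*-cong (F≐ps a b) (G≐qs a b)) (sym (sum₂-product ps qs a b))

  InA⊗A-resp : ∀ {F G} → F ≐₂ G → InA⊗A G → InA⊗A F
  InA⊗A-resp F≐G (ps , ps∈A , G≐ps) = ps , ps∈A , λ a b → trans (F≐G a b) (G≐ps a b)

  twoTerms : ∀ {f h f′ h′} → InA f → InA h → InA f′ → InA h′ → InA⊗A ((f ⊗ h) ⊕₂ (f′ ⊗ h′))
  twoTerms {f} {h} {f′} {h′} f∈A h∈A f′∈A h′∈A =
    ((f , h) ∷ (f′ , h′) ∷ []) , ((f∈A , h∈A) ∷ (f′∈A , h′∈A) ∷ []) ,
    λ a b → +-cong refl (sym (+-identityʳ _))

  module Closure (half : K) (half-spec : half * (1# + 1#) ≈ 1#) where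
    open Formulas half half-spec

    -- S is an algebra map of the dual, so it suffices to treat the generators
    S-closed : ∀ f → InA f → InA (S f)
    S-closed _ genE = resp (λ a → trans (-1*x≈-x _) (sym (S-E a))) (scal (- 1#) (mul (genΨ oneU) genE))
    S-closed _ (genΦ μ) = resp (λ a → sym (S-Φ μ a))
      (add (scal half (add (genΦ (unitInv μ)) (genΨ (unitInv μ)))) (scal half (A-sub (genΦ μ) (genΨ μ))))
    S-closed _ (genΨ μ) = resp (λ a → sym (S-Ψ μ a))
      (A-sub (scal half (add (genΦ (unitInv μ)) (genΨ (unitInv μ)))) (scal half (A-sub (genΦ μ) (genΨ μ))))
    S-closed _ unit       = unit
    S-closed _ (add p q)  = add (S-closed _ p) (S-closed _ q)
    S-closed _ (scal k p) = scal k (S-closed _ p)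
    S-closed _ (mul p q)  = mul (S-closed _ p) (S-closed _ q)
    S-closed _ (resp f≐h p) = resp (λ a → f≐h (inv a)) (S-closed _ p)

    -- Δ is linear and multiplicative, so the tensor lists combine accordingly
    Δ-closed : ∀ f → InA f → InA⊗A (Δ f)
    Δ-closed _ genE = InA⊗A-resp Δ-E (twoTerms genE unit (genΨ oneU) genE)
    Δ-closed _ (genΦ μ) = InA⊗A-resp (Δ-Φ μ)
      (twoTerms (scal half (add (genΦ μ) (genΨ μ))) (genΦ μ)
                (scal half (A-sub (genΦ μ) (genΨ μ))) (genΦ (unitInv μ)))
    Δ-closed _ (genΨ μ) = InA⊗A-resp (Δ-Ψ μ)
      (twoTerms (scal half (add (genΦ μ) (genΨ μ))) (genΨ μ)
                (A-neg (scal half (A-sub (genΦ μ) (genΨ μ)))) (genΨ (unitInv μ)))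
    Δ-closed _ unit = ((𝟙 , 𝟙) ∷ []) , ((unit , unit) ∷ []) , λ a b → sym (trans (+-identityʳ _) (*-identityʳ _))
    Δ-closed _ (add p q)  = InA⊗A-add (Δ-closed _ p) (Δ-closed _ q)
    Δ-closed _ (scal k p) = InA⊗A-scale k (Δ-closed _ p)
    Δ-closed _ (mul p q)  = InA⊗A-mul (Δ-closed _ p) (Δ-closed _ q)
    Δ-closed _ (resp f≐h p) = InA⊗A-resp (λ a b → sym (f≐h (a · b))) (Δ-closed _ p)

  -- Linear recurrences for two-sided sequences ℤ → K

  Seq : Set c
  Seq = ℤ → K

  _≋_ : Seq → Seq → Set ℓ
  s ≋ t = ∀ i → s i ≈ t i

  -- the difference operator T - μ, with T the shift i ↦ i + 1
  δ : Unit → Seq → Seq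
  δ μ s i = s (ℤ.suc i) - val μ * s i

  δ* : List Unit → Seq → Seq
  δ* []      s = s
  δ* (μ ∷ L) s = δ* L (δ μ s)

  Annihilates : List Unit → Seq → Set ℓ
  Annihilates L s = ∀ i → δ* L s i ≈ 0#

  δ-cong : ∀ μ {s t} → s ≋ t → δ μ s ≋ δ μ t
  δ-cong μ s≋t i = +-cong (s≋t (ℤ.suc i)) (-‿cong (*-cong refl (s≋t i)))

  δ*-cong : ∀ L {s t} → s ≋ t → δ* L s ≋ δ* L t
  δ*-cong []      s≋t = s≋t
  δ*-cong (μ ∷ L) s≋t = δ*-cong L (δ-cong μ s≋t)

  δ*-scale : ∀ L k s → δ* L (λ i → k * s i) ≋ (λ i → k * δ* L s i)
  δ*-scale []      k s i = refl
  δ*-scale (μ ∷ L) k s i = trans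
    (δ*-cong L {δ μ (λ i → k * s i)} {λ i → k * δ μ s i}
      (λ i → solve 4 (λ k a b m → k :* a :- m :* (k :* b) := k :* (a :- m :* b)) refl k (s (ℤ.suc i)) (s i) (val μ)) i)
    (δ*-scale L k (δ μ s) i)

  δ*-add : ∀ L s t → δ* L (λ i → s i + t i) ≋ (λ i → δ* L s i + δ* L t i)
  δ*-add []      s t i = refl
  δ*-add (μ ∷ L) s t i = trans
    (δ*-cong L {δ μ (λ i → s i + t i)} {λ i → δ μ s i + δ μ t i}
      (λ i → solve 5 (λ a b x y m → (a :+ x) :- m :* (b :+ y) := (a :- m :* b) :+ (x :- m :* y)) refl
               (s (ℤ.suc i)) (s i) (t (ℤ.suc i)) (t i) (val μ)) i)
    (δ*-add L (δ μ s) (δ μ t) i)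

  δ*-zero : ∀ L → Annihilates L (λ _ → 0#)
  δ*-zero []      i = refl
  δ*-zero (μ ∷ L) i = trans
    (δ*-cong L {δ μ (λ _ → 0#)} {λ _ → 0#} (λ i → solve 1 (λ m → con (+ 0) :- m :* con (+ 0) := con (+ 0)) refl (val μ)) i)
    (δ*-zero L i)

  δ-comm : ∀ μ ν s → δ μ (δ ν s) ≋ δ ν (δ μ s)
  δ-comm μ ν s i = solve 5 (λ a b x m n → (a :- n :* b) :- m :* (b :- n :* x) := (a :- m :* b) :- n :* (b :- m :* x)) refl
    (s (ℤ.suc (ℤ.suc i))) (s (ℤ.suc i)) (s i) (val μ) (val ν)

  δ*-δ : ∀ L μ s → δ* L (δ μ s) ≋ δ μ (δ* L s)
  δ*-δ []      μ s i = refl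
  δ*-δ (ν ∷ L) μ s i = trans (δ*-cong L (δ-comm ν μ s) i) (δ*-δ L μ (δ ν s) i)

  δ*-comm : ∀ L L′ s → δ* L (δ* L′ s) ≋ δ* L′ (δ* L s)
  δ*-comm L []       s i = refl
  δ*-comm L (ν ∷ L′) s i = trans (δ*-comm L L′ (δ ν s) i) (δ*-cong L′ (δ*-δ L ν s) i)

  δ*-++ : ∀ L L′ s → δ* (L ++ L′) s ≋ δ* L′ (δ* L s)
  δ*-++ []      L′ s i = refl
  δ*-++ (μ ∷ L) L′ s i = δ*-++ L L′ (δ μ s) i

  δ*-translate : ∀ L s t → δ* L (λ i → s (i ℤ.+ t)) ≋ (λ i → δ* L s (i ℤ.+ t))
  δ*-translate []      s t i = refl
  δ*-translate (μ ∷ L) s t i = trans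
    (δ*-cong L {δ μ (λ i → s (i ℤ.+ t))} {λ i → δ μ s (i ℤ.+ t)}
      (λ i → +-cong (reflexive (≡.cong s (ℤP.+-assoc (+ 1) i t))) refl) i)
    (δ*-translate L (δ μ s) t i)

  Annihilates-cong : ∀ L {s t} → s ≋ t → Annihilates L s → Annihilates L t
  Annihilates-cong L s≋t Ls i = trans (sym (δ*-cong L s≋t i)) (Ls i)

  Annihilates-scale : ∀ L k {s} → Annihilates L s → Annihilates L (λ i → k * s i)
  Annihilates-scale L k {s} Ls i = trans (δ*-scale L k s i) (trans (*-cong refl (Ls i)) (zeroʳ k))

  Annihilates-sum : ∀ L L′ {s t} → Annihilates L s → Annihilates L′ t →
                    Annihilates (L ++ L′) (λ i → s i + t i)
  Annihilates-sum L L′ {s} {t} Ls L′t i = begin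
    δ* (L ++ L′) (λ i → s i + t i) i              ≈⟨ δ*-++ L L′ _ i ⟩
    δ* L′ (δ* L (λ i → s i + t i)) i              ≈⟨ δ*-cong L′ (δ*-add L s t) i ⟩
    δ* L′ (λ i → δ* L s i + δ* L t i) i           ≈⟨ δ*-add L′ (δ* L s) (δ* L t) i ⟩
    δ* L′ (δ* L s) i + δ* L′ (δ* L t) i           ≈⟨ +-cong (δ*-cong L′ Ls i) (δ*-comm L′ L t i) ⟩
    δ* L′ (λ _ → 0#) i + δ* L (δ* L′ t) i         ≈⟨ +-cong (δ*-zero L′ i) (δ*-cong L L′t i) ⟩
    0# + δ* L (λ _ → 0#) i                        ≈⟨ +-cong refl (δ*-zero L i) ⟩
    0# + 0#                                       ≈⟨ +-identityʳ 0# ⟩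
    0#                                            ∎

  Annihilates-++ˡ : ∀ L L′ {s} → Annihilates L s → Annihilates (L ++ L′) s
  Annihilates-++ˡ L L′ {s} Ls =
    Annihilates-cong (L ++ L′) (λ i → +-identityʳ (s i)) (Annihilates-sum L L′ Ls (δ*-zero L′))

  Annihilates-++ʳ : ∀ L L′ {s} → Annihilates L′ s → Annihilates (L ++ L′) s
  Annihilates-++ʳ L L′ {s} L′s =
    Annihilates-cong (L ++ L′) (λ i → +-identityˡ (s i)) (Annihilates-sum L L′ (δ*-zero L) L′s)

  Annihilates-translate : ∀ L {s} → Annihilates L s → ∀ t → Annihilates L (λ i → s (i ℤ.+ t))
  Annihilates-translate L {s} Ls t i = trans (δ*-translate L s t i) (Ls (i ℤ.+ t))

  -- Reflecting the index inverts the roots: if L kills s then L⁻¹ kills i ↦ s (t - i),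
  -- because -μ⁻¹ (T - μ) becomes T - μ⁻¹ after reflection.
  invertRoots : List Unit → List Unit
  invertRoots = List.map unitInv

  δ-reflect : ∀ μ s t i → (- val⁻¹ μ) * δ μ s (ℤ.- i ℤ.+ ℤ.pred t) ≈ δ (unitInv μ) (λ i → s (ℤ.- i ℤ.+ t)) i
  δ-reflect μ s t i = begin
    (- val⁻¹ μ) * (s (ℤ.suc (ℤ.- i ℤ.+ ℤ.pred t)) - val μ * s (ℤ.- i ℤ.+ ℤ.pred t))
      ≡⟨ ≡.cong₂ (λ u v → (- val⁻¹ μ) * (s u - val μ * s v)) (index-suc i t) (index-pred i t) ⟩
    (- val⁻¹ μ) * (s (ℤ.- i ℤ.+ t) - val μ * s (ℤ.- ℤ.suc i ℤ.+ t))
      ≈⟨ solve 4 (λ m l y x → (:- m) :* (y :- l :* x) := (m :* l) :* x :- m :* y) refl (val⁻¹ μ) (val μ) _ _ ⟩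
    (val⁻¹ μ * val μ) * s (ℤ.- ℤ.suc i ℤ.+ t) - val⁻¹ μ * s (ℤ.- i ℤ.+ t)
      ≈⟨ +-cong (trans (*-cong (val⁻¹*val μ) refl) (*-identityˡ _)) refl ⟩
    s (ℤ.- ℤ.suc i ℤ.+ t) - val⁻¹ μ * s (ℤ.- i ℤ.+ t) ∎
    where
    index-suc : ∀ i t → ℤ.suc (ℤ.- i ℤ.+ ℤ.pred t) ≡ ℤ.- i ℤ.+ t
    index-suc = ℤS.solve 2 (λ i t → ℤS.con (+ 1) ℤS.:+ (ℤS.:- i ℤS.:+ (ℤS.con -[1+ 0 ] ℤS.:+ t)) ℤS.:= ℤS.:- i ℤS.:+ t) ≡.refl
    index-pred : ∀ i t → ℤ.- i ℤ.+ ℤ.pred t ≡ ℤ.- ℤ.suc i ℤ.+ t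
    index-pred = ℤS.solve 2 (λ i t → ℤS.:- i ℤS.:+ (ℤS.con -[1+ 0 ] ℤS.:+ t) ℤS.:= ℤS.:- (ℤS.con (+ 1) ℤS.:+ i) ℤS.:+ t) ≡.refl

  Annihilates-reflect : ∀ L s → Annihilates L s → ∀ t → Annihilates (invertRoots L) (λ i → s (ℤ.- i ℤ.+ t))
  Annihilates-reflect []      s Ls t i = Ls (ℤ.- i ℤ.+ t)
  Annihilates-reflect (μ ∷ L) s Ls t = Annihilates-cong (invertRoots L) (δ-reflect μ s t)
    (Annihilates-reflect L (λ i → (- val⁻¹ μ) * δ μ s i) (Annihilates-scale L (- val⁻¹ μ) Ls) (ℤ.pred t))

  -- Products: by the Leibniz rule
  --   (T - μν)(s t) = (T s) · (T - ν) t + ν · ((T - μ) s) · t,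
  -- s t is killed by the roots μν for μ, ν running through the roots of s and t.
  mulUnit : Unit → Unit → Unit
  mulUnit μ ν = (val μ * val ν , val⁻¹ μ * val⁻¹ ν) , product-inverse
    where
    product-inverse : (val μ * val ν) * (val⁻¹ μ * val⁻¹ ν) ≈ 1#
    product-inverse = trans
      (solve 4 (λ a b x y → (a :* b) :* (x :* y) := (x :* a) :* (y :* b)) refl (val μ) (val ν) (val⁻¹ μ) (val⁻¹ ν))
      (trans (*-cong (val⁻¹*val μ) (val⁻¹*val ν)) (*-identityʳ 1#))

  productRoots : List Unit → List Unit → List Unit
  productRoots []      L₂      = []
  productRoots (μ ∷ L₁) []      = []
  productRoots (μ ∷ L₁) (ν ∷ L₂) = mulUnit μ ν ∷ (productRoots (μ ∷ L₁) L₂ ++ productRoots L₁ (ν ∷ L₂))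

  leibniz : ∀ μ ν s t i → s (ℤ.suc i) * δ ν t i + val ν * (δ μ s i * t i) ≈ δ (mulUnit μ ν) (λ i → s i * t i) i
  leibniz μ ν s t i = solve 6
    (λ s′ t′ s₀ t₀ m n → s′ :* (t′ :- n :* t₀) :+ n :* ((s′ :- m :* s₀) :* t₀) := s′ :* t′ :- (m :* n) :* (s₀ :* t₀))
    refl (s (ℤ.suc i)) (t (ℤ.suc i)) (s i) (t i) (val μ) (val ν)

  Annihilates-shift : ∀ L {s} → Annihilates L s → Annihilates L (λ i → s (ℤ.suc i))
  Annihilates-shift L {s} Ls =
    Annihilates-cong L (λ i → reflexive (≡.cong s (ℤP.+-comm i (+ 1)))) (Annihilates-translate L Ls (+ 1))

  Annihilates-product : ∀ L₁ L₂ s t → Annihilates L₁ s → Annihilates L₂ t →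
                        Annihilates (productRoots L₁ L₂) (λ i → s i * t i)
  Annihilates-product []       L₂       s t L₁s L₂t i = trans (*-cong (L₁s i) refl) (zeroˡ _)
  Annihilates-product (μ ∷ L₁) []       s t L₁s L₂t i = trans (*-cong refl (L₂t i)) (zeroʳ _)
  Annihilates-product (μ ∷ L₁) (ν ∷ L₂) s t L₁s L₂t =
    Annihilates-cong (productRoots (μ ∷ L₁) L₂ ++ productRoots L₁ (ν ∷ L₂)) (leibniz μ ν s t)
      (Annihilates-sum (productRoots (μ ∷ L₁) L₂) (productRoots L₁ (ν ∷ L₂))
        (Annihilates-product (μ ∷ L₁) L₂ (λ i → s (ℤ.suc i)) (δ ν t) (Annihilates-shift (μ ∷ L₁) L₁s) L₂t)
        (Annihilates-scale (productRoots L₁ (ν ∷ L₂)) (val ν) (Annihilates-product L₁ (ν ∷ L₂) (δ μ s) t L₁s L₂t)))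

  -- Every element of A, and every translate of it, satisfies a recurrence

  Recurrent : List Unit → Fun → Set ℓ
  Recurrent L f = ∀ j → Annihilates L (λ i → f (i , j))

  E-recurrent : Recurrent (oneU ∷ oneU ∷ []) E
  E-recurrent j i = begin
    δ oneU (δ oneU intK) i   ≈⟨ δ-cong oneU {δ oneU intK} {λ _ → 1#} constant-difference i ⟩
    1# - 1# * 1#             ≈⟨ solve 0 (con (+ 1) :- con (+ 1) :* con (+ 1) := con (+ 0)) refl ⟩
    0#                       ∎
    where
    constant-difference : ∀ i → intK (ℤ.suc i) - 1# * intK i ≈ 1#
    constant-difference i = trans (+-cong (intK-+ (+ 1) i) refl)
      (solve 1 (λ x → (con (+ 1) :+ con (+ 0)) :+ x :- con (+ 1) :* x := con (+ 1)) refl (intK i))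

  Φ-recurrent : ∀ μ → Recurrent (μ ∷ []) (Φ μ)
  Φ-recurrent μ j i = trans (+-cong (zpow-suc μ i) refl) (-‿inverseʳ _)

  Ψ-recurrent : ∀ μ → Recurrent (μ ∷ []) (Ψ μ)
  Ψ-recurrent μ j i = trans (+-cong (*-cong (zpow-suc μ i) refl) refl)
    (solve 3 (λ a x s → (a :* x) :* s :- a :* (x :* s) := con (+ 0)) refl (val μ) (zpow μ i) (sign j))

  𝟙-recurrent : Recurrent (oneU ∷ []) 𝟙
  𝟙-recurrent j i = solve 0 (con (+ 1) :- con (+ 1) :* con (+ 1) := con (+ 0)) refl

  A-recurrent : ∀ f → InA f → Σ (List Unit) λ L → Recurrent L f
  A-recurrent _ genE     = (oneU ∷ oneU ∷ []) , E-recurrent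
  A-recurrent _ (genΦ μ) = (μ ∷ []) , Φ-recurrent μ
  A-recurrent _ (genΨ μ) = (μ ∷ []) , Ψ-recurrent μ
  A-recurrent _ unit     = (oneU ∷ []) , 𝟙-recurrent
  A-recurrent _ (add p q) with A-recurrent _ p | A-recurrent _ q
  ... | L₁ , fL₁ | L₂ , hL₂ = L₁ ++ L₂ , λ j → Annihilates-sum L₁ L₂ (fL₁ j) (hL₂ j)
  A-recurrent _ (scal k p) with A-recurrent _ p
  ... | L , fL = L , λ j → Annihilates-scale L k (fL j)
  A-recurrent _ (mul {f} {h} p q) with A-recurrent _ p | A-recurrent _ q
  ... | L₁ , fL₁ | L₂ , hL₂ = productRoots L₁ L₂ , λ j →
    Annihilates-product L₁ L₂ (λ i → f (i , j)) (λ i → h (i , j)) (fL₁ j) (hL₂ j)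
  A-recurrent _ (resp f≐h p) with A-recurrent _ p
  ... | L , fL = L , λ j → Annihilates-cong L (λ i → f≐h (i , j)) (fL j)

  ·-assoc : ∀ a b d → (a · b) · d ≡ a · (b · d)
  ·-assoc (i , false) (k , false) (m , r)     = ≡.cong (_, r) (ℤP.+-assoc i k m)
  ·-assoc (i , false) (k , true)  (m , r)     = ≡.cong (_, true xor r) (ℤP.+-assoc i k (ℤ.- m))
  ·-assoc (i , true)  (k , false) (m , r)     = ≡.cong (_, true xor r)
    (≡.trans (ℤP.+-assoc i (ℤ.- k) (ℤ.- m)) (≡.cong (λ z → i ℤ.+ z) (≡.sym (ℤP.neg-distrib-+ k m))))
  ·-assoc (i , true)  (k , true)  (m , false) = ≡.cong (_, false)
    (≡.trans (ℤP.+-assoc i (ℤ.- k) m) (≡.cong (λ z → i ℤ.+ z) (-k+m≡-[k-m] k m)))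
    where -k+m≡-[k-m] = ℤS.solve 2 (λ k m → ℤS.:- k ℤS.:+ m ℤS.:= ℤS.:- (k ℤS.:+ ℤS.:- m)) ≡.refl
  ·-assoc (i , true)  (k , true)  (m , true)  = ≡.cong (_, true)
    (≡.trans (ℤP.+-assoc i (ℤ.- k) m) (≡.cong (λ z → i ℤ.+ z) (-k+m≡-[k-m] k m)))
    where -k+m≡-[k-m] = ℤS.solve 2 (λ k m → ℤS.:- k ℤS.:+ m ℤS.:= ℤS.:- (k ℤS.:+ ℤS.:- m)) ≡.refl

  e-unit : ∀ d → (e · d) · e ≡ d
  e-unit (i , false) = ≡.cong (_, false) (≡.trans (ℤP.+-identityʳ _) (ℤP.+-identityˡ i))
  e-unit (i , true)  = ≡.cong (_, true) (≡.trans (ℤP.+-identityʳ _) (ℤP.+-identityˡ i))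

  translate : D∞ → D∞ → Fun → Fun
  translate a b f d = f ((a · d) · b)

  withInverses : List Unit → List Unit
  withInverses L = L ++ invertRoots L

  -- Translating by g^p x^q on the left and g^r x^s on the right turns the
  -- sequence on one coset into a shift of the sequence on a coset (q = 0) or
  -- into a reflection of it (q = 1); the right factor only moves the coset.
  translate-recurrent : ∀ L f → Recurrent L f → ∀ a b → Recurrent (withInverses L) (translate a b f)
  translate-recurrent L f fL (p , false) (r , s) false = Annihilates-++ˡ L (invertRoots L)
    (Annihilates-cong L (λ i → reflexive (≡.cong (λ z → f (z , s))
        (ℤS.solve 3 (λ i p r → i ℤS.:+ (p ℤS.:+ r) ℤS.:= (p ℤS.:+ i) ℤS.:+ r) ≡.refl i p r)))
      (Annihilates-translate L (fL s) (p ℤ.+ r)))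
  translate-recurrent L f fL (p , false) (r , s) true = Annihilates-++ˡ L (invertRoots L)
    (Annihilates-cong L (λ i → reflexive (≡.cong (λ z → f (z , true xor s))
        (ℤS.solve 3 (λ i p r → i ℤS.:+ (p ℤS.:+ ℤS.:- r) ℤS.:= (p ℤS.:+ i) ℤS.:+ ℤS.:- r) ≡.refl i p r)))
      (Annihilates-translate L (fL (true xor s)) (p ℤ.+ ℤ.- r)))
  translate-recurrent L f fL (p , true) (r , s) false = Annihilates-++ʳ L (invertRoots L)
    (Annihilates-cong (invertRoots L) (λ i → reflexive (≡.cong (λ z → f (z , true xor s))
        (ℤS.solve 3 (λ i p r → ℤS.:- i ℤS.:+ (p ℤS.:+ ℤS.:- r) ℤS.:= (p ℤS.:+ ℤS.:- i) ℤS.:+ ℤS.:- r) ≡.refl i p r)))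
      (Annihilates-reflect L (λ i → f (i , true xor s)) (fL (true xor s)) (p ℤ.+ ℤ.- r)))
  translate-recurrent L f fL (p , true) (r , s) true = Annihilates-++ʳ L (invertRoots L)
    (Annihilates-cong (invertRoots L) (λ i → reflexive (≡.cong (λ z → f (z , s))
        (ℤS.solve 3 (λ i p r → ℤS.:- i ℤS.:+ (p ℤS.:+ r) ℤS.:= (p ℤS.:+ ℤS.:- i) ℤS.:+ r) ≡.refl i p r)))
      (Annihilates-reflect L (λ i → f (i , s)) (fL s) (p ℤ.+ r)))

  -- A solution of a recurrence is determined linearly by finitely many values

  -- the coefficient vector v stands for the linear form s ↦ Σ_{k < n} v_k s(k)
  ev : ∀ {n} → Vec K n → Seq → K
  ev []       s = 0#
  ev (c ∷ cs) s = c * s (+ 0) + ev cs (λ i → s (ℤ.suc i))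

  ev-cong : ∀ {n} (v : Vec K n) {s t} → s ≋ t → ev v s ≈ ev v t
  ev-cong []      s≋t = refl
  ev-cong (c ∷ v) s≋t = +-cong (*-cong refl (s≋t (+ 0))) (ev-cong v (λ i → s≋t (ℤ.suc i)))

  zeros : ∀ n → Vec K n
  zeros n = Vec.replicate n 0#

  ev-zeros : ∀ n s → ev (zeros n) s ≈ 0#
  ev-zeros zero    s = refl
  ev-zeros (suc n) s = trans (+-cong (zeroˡ _) (ev-zeros n _)) (+-identityʳ 0#)

  combine : ∀ {n} → K → Vec K n → K → Vec K n → Vec K n
  combine a x b y = Vec.zipWith (λ p q → a * p + b * q) x y

  distribute : ∀ a b p q u x y → (a * p + b * q) * u + (a * x + b * y) ≈ a * (p * u + x) + b * (q * u + y)
  distribute = solve 7 (λ a b p q u x y → (a :* p :+ b :* q) :* u :+ (a :* x :+ b :* y)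
                                          := a :* (p :* u :+ x) :+ b :* (q :* u :+ y)) refl

  ev-combine : ∀ {n} a (x : Vec K n) b y s → ev (combine a x b y) s ≈ a * ev x s + b * ev y s
  ev-combine a []      b []      s = solve 2 (λ a b → con (+ 0) := a :* con (+ 0) :+ b :* con (+ 0)) refl a b
  ev-combine a (p ∷ x) b (q ∷ y) s = trans (+-cong refl (ev-combine a x b y _))
    (distribute a b p q (s (+ 0)) (ev x (λ i → s (ℤ.suc i))) (ev y (λ i → s (ℤ.suc i))))

  ev-∷ʳ0 : ∀ {n} (v : Vec K n) s → ev (v Vec.∷ʳ 0#) s ≈ ev v s
  ev-∷ʳ0 []      s = trans (+-cong (zeroˡ _) refl) (+-identityʳ 0#)
  ev-∷ʳ0 (c ∷ v) s = +-cong refl (ev-∷ʳ0 v _)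

  ev-δ : ∀ {n} (v : Vec K n) μ s → ev v (δ μ s) ≈ ev v (λ i → s (ℤ.suc i)) - val μ * ev v s
  ev-δ []      μ s = solve 1 (λ m → con (+ 0) := con (+ 0) :- m :* con (+ 0)) refl (val μ)
  ev-δ (c ∷ v) μ s = trans (+-cong refl (ev-δ v μ (λ i → s (ℤ.suc i))))
    (solve 6 (λ c s₁ s₀ x y m → c :* (s₁ :- m :* s₀) :+ (x :- m :* y) := (c :* s₁ :+ x) :- m :* (c :* s₀ :+ y))
      refl c (s (+ 1)) (s (+ 0)) (ev v (λ i → s (ℤ.suc (ℤ.suc i)))) (ev v (λ i → s (ℤ.suc i))) (val μ))

  Represents : ∀ {n} → List Unit → ℤ → Vec K n → Set (c Level.⊔ ℓ)
  Represents L i v = ∀ s → Annihilates L s → s i ≈ ev v s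

  -- Passing from L to μ ∷ L: the values of s are recovered from those of (T - μ) s,
  -- which L kills, by s(i+1) = (T - μ) s (i) + μ s(i) going up and
  -- s(i) = μ⁻¹ s(i+1) - μ⁻¹ (T - μ) s (i) going down.
  module RepresentationStep (μ : Unit) (L : List Unit)
           (represent : ∀ i → Σ (Vec K (List.length L)) (Represents L i)) where
    D : ℕ
    D = List.length L

    -- the coefficients of v ∘ (T - μ)
    throughδ : Vec K D → Vec K (suc D)
    throughδ v = combine 1# (0# ∷ v) (- val μ) (v Vec.∷ʳ 0#)

    ev-throughδ : ∀ v s → ev v (δ μ s) ≈ ev (throughδ v) s
    ev-throughδ v s = sym (begin
      ev (throughδ v) s
        ≈⟨ ev-combine 1# (0# ∷ v) (- val μ) (v Vec.∷ʳ 0#) s ⟩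
      1# * (0# * s (+ 0) + ev v (λ i → s (ℤ.suc i))) + (- val μ) * ev (v Vec.∷ʳ 0#) s
        ≈⟨ +-cong refl (*-cong refl (ev-∷ʳ0 v s)) ⟩
      1# * (0# * s (+ 0) + ev v (λ i → s (ℤ.suc i))) + (- val μ) * ev v s
        ≈⟨ solve 4 (λ s₀ x m y → con (+ 1) :* (con (+ 0) :* s₀ :+ x) :+ (:- m) :* y := x :- m :* y)
             refl (s (+ 0)) _ (val μ) _ ⟩
      ev v (λ i → s (ℤ.suc i)) - val μ * ev v s
        ≈⟨ sym (ev-δ v μ s) ⟩
      ev v (δ μ s) ∎)

    δ-value : ∀ i s → Annihilates (μ ∷ L) s → δ μ s i ≈ ev (throughδ (proj₁ (represent i))) s
    δ-value i s s∈ = trans (proj₂ (represent i) (δ μ s) s∈) (ev-throughδ (proj₁ (represent i)) s)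

    Representation : ℤ → Set (c Level.⊔ ℓ)
    Representation i = Σ (Vec K (suc D)) (Represents (μ ∷ L) i)

    at-zero : Representation (+ 0)
    at-zero = (1# ∷ zeros D) , λ s _ → sym (trans (+-cong (*-identityˡ _) (ev-zeros D _)) (+-identityʳ _))

    step-up : ∀ i → Representation i → Representation (ℤ.suc i)
    step-up i (v , rep) = combine 1# w (val μ) v , λ s s∈ → begin
      s (ℤ.suc i)                     ≈⟨ solve 3 (λ a b m → a := (a :- m :* b) :+ m :* b) refl (s (ℤ.suc i)) (s i) (val μ) ⟩
      δ μ s i + val μ * s i           ≈⟨ +-cong (δ-value i s s∈) (*-cong refl (rep s s∈)) ⟩
      ev w s + val μ * ev v s         ≈⟨ +-cong (sym (*-identityˡ _)) refl ⟩
      1# * ev w s + val μ * ev v s    ≈⟨ sym (ev-combine 1# w (val μ) v s) ⟩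
      ev (combine 1# w (val μ) v) s   ∎
      where
      w = throughδ (proj₁ (represent i))

    step-down : ∀ i → Representation (ℤ.suc i) → Representation i
    step-down i (v , rep) = combine (val⁻¹ μ) v (- val⁻¹ μ) w , λ s s∈ → begin
      s i                                              ≈⟨ backwards s ⟩
      val⁻¹ μ * s (ℤ.suc i) + (- val⁻¹ μ) * δ μ s i    ≈⟨ +-cong (*-cong refl (rep s s∈)) (*-cong refl (δ-value i s s∈)) ⟩
      val⁻¹ μ * ev v s + (- val⁻¹ μ) * ev w s          ≈⟨ sym (ev-combine (val⁻¹ μ) v (- val⁻¹ μ) w s) ⟩
      ev (combine (val⁻¹ μ) v (- val⁻¹ μ) w) s         ∎
      where
      w = throughδ (proj₁ (represent i))
      backwards : ∀ s → s i ≈ val⁻¹ μ * s (ℤ.suc i) + (- val⁻¹ μ) * δ μ s i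
      backwards s = sym (trans
        (solve 4 (λ m l a b → m :* a :+ (:- m) :* (a :- l :* b) := (m :* l) :* b) refl (val⁻¹ μ) (val μ) (s (ℤ.suc i)) (s i))
        (trans (*-cong (val⁻¹*val μ) refl) (*-identityˡ _)))

    upward : ∀ n → Representation (+ n)
    upward zero    = at-zero
    upward (suc n) = step-up (+ n) (upward n)

    downward : ∀ n → Representation -[1+ n ]
    downward zero    = step-down -[1+ 0 ] at-zero
    downward (suc n) = step-down -[1+ suc n ] (downward n)

    represent-∷ : ∀ i → Representation i
    represent-∷ (+ n)    = upward n
    represent-∷ -[1+ n ] = downward n

  represent : ∀ L i → Σ (Vec K (List.length L)) (Represents L i)
  represent []      i = [] , λ s s∈ → s∈ i
  represent (μ ∷ L)   = RepresentationStep.represent-∷ μ L (represent L)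

  -- A lies in the finite dual

  ⟪⟫-++ : ∀ h u v → ⟪ h ⟫ (u ++ v) ≈ ⟪ h ⟫ u + ⟪ h ⟫ v
  ⟪⟫-++ h []            v = sym (+-identityˡ _)
  ⟪⟫-++ h ((k , a) ∷ u) v = trans (+-cong refl (⟪⟫-++ h u v)) (sym (+-assoc _ _ _))

  ⟪⟫-scale : ∀ h k u → ⟪ h ⟫ (scaleKG k u) ≈ k * ⟪ h ⟫ u
  ⟪⟫-scale h k []             = sym (zeroʳ k)
  ⟪⟫-scale h k ((k′ , a) ∷ u) = trans (+-cong (*-assoc _ _ _) (⟪⟫-scale h k u)) (sym (distribˡ _ _ _))

  ⟪⟫-cong : ∀ {h h′} u → h ≐ h′ → ⟪ h ⟫ u ≈ ⟪ h′ ⟫ u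
  ⟪⟫-cong []            h≐h′ = refl
  ⟪⟫-cong ((k , a) ∷ u) h≐h′ = +-cong (*-cong refl (h≐h′ a)) (⟪⟫-cong u h≐h′)

  ⟪⟫-lmul : ∀ h b u → ⟪ h ⟫ (lmulKG b u) ≈ ⟪ (λ d → h (b · d)) ⟫ u
  ⟪⟫-lmul h b []            = refl
  ⟪⟫-lmul h b ((k , a) ∷ u) = +-cong refl (⟪⟫-lmul h b u)

  ⟪⟫-rmul : ∀ h b u → ⟪ h ⟫ (rmulKG b u) ≈ ⟪ (λ d → h (d · b)) ⟫ u
  ⟪⟫-rmul h b []            = refl
  ⟪⟫-rmul h b ((k , a) ∷ u) = +-cong refl (⟪⟫-rmul h b u)

  pairing : ∀ {n} → Vec K n → Vec KG n → Fun → K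
  pairing []      []      h = 0#
  pairing (x ∷ v) (b ∷ bs) h = x * ⟪ h ⟫ b + pairing v bs h

  ⟪⟫-lincomb : ∀ h {n} (v : Vec K n) bs → ⟪ h ⟫ (lincomb (Vec.lookup v) (Vec.lookup bs)) ≈ pairing v bs h
  ⟪⟫-lincomb h []      []       = refl
  ⟪⟫-lincomb h (x ∷ v) (b ∷ bs) = trans (⟪⟫-++ h (scaleKG x b) _) (+-cong (⟪⟫-scale h x b) (⟪⟫-lincomb h v bs))

  pairing-++ : ∀ {m n} (x : Vec K m) (y : Vec K n) bs cs h →
               pairing (x Vec.++ y) (bs Vec.++ cs) h ≈ pairing x bs h + pairing y cs h
  pairing-++ []      y []       cs h = sym (+-identityˡ _)
  pairing-++ (p ∷ x) y (b ∷ bs) cs h = trans (+-cong refl (pairing-++ x y bs cs h)) (sym (+-assoc _ _ _))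

  pairing-combine : ∀ {n} a (x : Vec K n) b y bs h →
                    pairing (combine a x b y) bs h ≈ a * pairing x bs h + b * pairing y bs h
  pairing-combine a []      b []      []        h = solve 2 (λ a b → con (+ 0) := a :* con (+ 0) :+ b :* con (+ 0)) refl a b
  pairing-combine a (p ∷ x) b (q ∷ y) (β ∷ bs) h = trans (+-cong refl (pairing-combine a x b y bs h))
    (distribute a b p q (⟪ h ⟫ β) (pairing x bs h) (pairing y bs h))

  pairing-zeros : ∀ n bs h → pairing (zeros n) bs h ≈ 0#
  pairing-zeros zero    []       h = refl
  pairing-zeros (suc n) (b ∷ bs) h = trans (+-cong (zeroˡ _) (pairing-zeros n bs h)) (+-identityʳ 0#)

  cosetBasis : Bool → ℕ → (n : ℕ) → Vec KG n
  cosetBasis j m zero    = []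
  cosetBasis j m (suc n) = ((1# , (+ m , j)) ∷ []) ∷ cosetBasis j (suc m) n

  pairing-cosetBasis : ∀ j {n} m (v : Vec K n) h → pairing v (cosetBasis j m n) h ≈ ev v (λ i → h (+ m ℤ.+ i , j))
  pairing-cosetBasis j m []      h = refl
  pairing-cosetBasis j m (x ∷ v) h = +-cong
    (*-cong refl (trans (+-identityʳ _) (trans (*-identityˡ _)
      (reflexive (≡.cong (λ z → h (z , j)) (≡.sym (ℤP.+-identityʳ (+ m))))))))
    (trans (pairing-cosetBasis j (suc m) v h) (ev-cong v (λ i → reflexive (≡.cong (λ z → h (z , j))
      (ℤS.solve 2 (λ m i → (ℤS.con (+ 1) ℤS.:+ m) ℤS.:+ i ℤS.:= m ℤS.:+ (ℤS.con (+ 1) ℤS.:+ i)) ≡.refl (+ m) i)))))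

  module FiniteCodimension (f : Fun) (L : List Unit) (fL : Recurrent L f) where
    D : ℕ
    D = List.length (withInverses L)

    I : KG → Set (c Level.⊔ ℓ)
    I u = Lift c (∀ a b → ⟪ translate a b f ⟫ u ≈ 0#)

    basis : Vec KG (D ℕ.+ D)
    basis = cosetBasis false 0 D Vec.++ cosetBasis true 0 D

    onCoset : Bool → Vec K D → Vec K (D ℕ.+ D)
    onCoset false v = v Vec.++ zeros D
    onCoset true  v = zeros D Vec.++ v

    pairing-onCoset : ∀ j v h → pairing (onCoset j v) basis h ≈ ev v (λ i → h (i , j))
    pairing-onCoset false v h = begin
      pairing (v Vec.++ zeros D) basis h
        ≈⟨ pairing-++ v (zeros D) (cosetBasis false 0 D) (cosetBasis true 0 D) h ⟩
      pairing v (cosetBasis false 0 D) h + pairing (zeros D) (cosetBasis true 0 D) h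
        ≈⟨ +-cong (pairing-cosetBasis false 0 v h) (pairing-zeros D (cosetBasis true 0 D) h) ⟩
      ev v (λ i → h (+ 0 ℤ.+ i , false)) + 0#
        ≈⟨ +-identityʳ _ ⟩
      ev v (λ i → h (+ 0 ℤ.+ i , false))
        ≈⟨ ev-cong v (λ i → reflexive (≡.cong (λ z → h (z , false)) (ℤP.+-identityˡ i))) ⟩
      ev v (λ i → h (i , false)) ∎
    pairing-onCoset true v h = begin
      pairing (zeros D Vec.++ v) basis h
        ≈⟨ pairing-++ (zeros D) v (cosetBasis false 0 D) (cosetBasis true 0 D) h ⟩
      pairing (zeros D) (cosetBasis false 0 D) h + pairing v (cosetBasis true 0 D) h
        ≈⟨ +-cong (pairing-zeros D (cosetBasis false 0 D) h) (pairing-cosetBasis true 0 v h) ⟩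
      0# + ev v (λ i → h (+ 0 ℤ.+ i , true))
        ≈⟨ +-identityˡ _ ⟩
      ev v (λ i → h (+ 0 ℤ.+ i , true))
        ≈⟨ ev-cong v (λ i → reflexive (≡.cong (λ z → h (z , true)) (ℤP.+-identityˡ i))) ⟩
      ev v (λ i → h (i , true)) ∎

    coordinates : KG → Vec K (D ℕ.+ D)
    coordinates []                  = zeros (D ℕ.+ D)
    coordinates ((k , (i , j)) ∷ u) =
      combine k (onCoset j (proj₁ (represent (withInverses L) i))) 1# (coordinates u)

    pairing-coordinates : ∀ h → Recurrent (withInverses L) h → ∀ u → ⟪ h ⟫ u ≈ pairing (coordinates u) basis h
    pairing-coordinates h hL []                  = sym (pairing-zeros _ basis h)
    pairing-coordinates h hL ((k , (i , j)) ∷ u) = begin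
      k * h (i , j) + ⟪ h ⟫ u
        ≈⟨ +-cong (*-cong refl (trans (proj₂ (represent (withInverses L) i) (λ i → h (i , j)) (hL j))
                                      (sym (pairing-onCoset j v h))))
                  (trans (pairing-coordinates h hL u) (sym (*-identityˡ _))) ⟩
      k * pairing (onCoset j v) basis h + 1# * pairing (coordinates u) basis h
        ≈⟨ sym (pairing-combine k (onCoset j v) 1# (coordinates u) basis h) ⟩
      pairing (coordinates ((k , (i , j)) ∷ u)) basis h ∎
      where
      v = proj₁ (represent (withInverses L) i)

    residue : KG → KG
    residue u = u ++ scaleKG (- 1#) (lincomb (Vec.lookup (coordinates u)) (Vec.lookup basis))

    residue-vanishes : ∀ h → Recurrent (withInverses L) h → ∀ u → ⟪ h ⟫ (residue u) ≈ 0#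
    residue-vanishes h hL u = begin
      ⟪ h ⟫ (u ++ scaleKG (- 1#) rest)       ≈⟨ ⟪⟫-++ h u (scaleKG (- 1#) rest) ⟩
      ⟪ h ⟫ u + ⟪ h ⟫ (scaleKG (- 1#) rest)  ≈⟨ +-cong refl (⟪⟫-scale h (- 1#) rest) ⟩
      ⟪ h ⟫ u + (- 1#) * ⟪ h ⟫ rest          ≈⟨ +-cong (pairing-coordinates h hL u) (*-cong refl (⟪⟫-lincomb h (coordinates u) basis)) ⟩
      x + (- 1#) * x                         ≈⟨ solve 1 (λ x → x :+ con -[1+ 0 ] :* x := con (+ 0)) refl x ⟩
      0#                                     ∎
      where
      rest = lincomb (Vec.lookup (coordinates u)) (Vec.lookup basis)
      x = pairing (coordinates u) basis h

    finiteCodim : FinCodim I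
    finiteCodim = D ℕ.+ D , Vec.lookup basis , λ u → Vec.lookup (coordinates u) ,
      lift (λ a b → residue-vanishes (translate a b f) (translate-recurrent L f fL a b) u)

    -- I is a two-sided ideal: translating u translates the functionals that must vanish on it
    ideal : IsIdeal I
    ideal = record
      { +-closed     = λ u v (lift u∈I) (lift v∈I) → lift λ a b →
          trans (⟪⟫-++ (translate a b f) u v) (trans (+-cong (u∈I a b) (v∈I a b)) (+-identityʳ 0#))
      ; scale-closed = λ k u (lift u∈I) → lift λ a b →
          trans (⟪⟫-scale (translate a b f) k u) (trans (*-cong refl (u∈I a b)) (zeroʳ k))
      ; lmul-closed  = λ d u (lift u∈I) → lift λ a b →
          trans (⟪⟫-lmul (translate a b f) d u)
            (trans (⟪⟫-cong u (λ x → reflexive (≡.cong (λ z → f (z · b)) (≡.sym (·-assoc a d x))))) (u∈I (a · d) b))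
      ; rmul-closed  = λ d u (lift u∈I) → lift λ a b →
          trans (⟪⟫-rmul (translate a b f) d u)
            (trans (⟪⟫-cong u (λ x → reflexive (≡.cong f (≡.trans (≡.cong (_· b) (≡.sym (·-assoc a x d))) (·-assoc (a · x) d b)))))
              (u∈I a (d · b)))
      }

    -- f is its own translate by e on both sides
    vanishes : ∀ u → I u → ⟪ f ⟫ u ≈ 0#
    vanishes u (lift u∈I) = trans (⟪⟫-cong u (λ d → reflexive (≡.cong f (≡.sym (e-unit d))))) (u∈I e e)

  finiteDual : ∀ f → InA f → InFiniteDual f
  finiteDual f f∈A with A-recurrent f f∈A
  ... | L , fL = I , ideal , finiteCodim , vanishes
    where open FiniteCodimension f L fL

  half-exists : IsField → CharZero → Σ K λ half → half * (1# + 1#) ≈ 1#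
  half-exists isField charZero = proj₁ 2⁻¹ , trans (*-comm _ _) (proj₂ 2⁻¹)
    where
    2≉0 : ¬ (1# + 1# ≈ 0#)
    2≉0 2≈0 = charZero 1 (trans (+-cong refl (+-identityʳ 1#)) 2≈0)
    2⁻¹ : Σ K λ y → (1# + 1#) * y ≈ 1#
    2⁻¹ = IsField.inverse isField (1# + 1#) 2≉0

lemma11 : ∀ {c ℓ} (R : CommutativeRing c ℓ) →
    let open WithRing R
    in IsField → CharZero → AlgClosed →
       -- A is a Hopf subalgebra of (k D∞)°
       (∀ f → InA f → InFiniteDual f)
       × (∀ f → InA f → InA⊗A (Δ f))
       × (∀ f → InA f → InA (S f))
       -- coproduct, counit and antipode on the generators
       × (Δ E ≐₂ ((E ⊗ 𝟙) ⊕₂ (Ψ oneU ⊗ E)))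
       × (∀ (half : K) → half * (1# + 1#) ≈ 1# → ∀ (l : Unit) →
            (Δ (Φ l) ≐₂ (((half ⊙ (Φ l ⊕ Ψ l)) ⊗ Φ l)
                         ⊕₂ ((half ⊙ (Φ l ⊖ Ψ l)) ⊗ Φ (unitInv l))))
            × (Δ (Ψ l) ≐₂ (((half ⊙ (Φ l ⊕ Ψ l)) ⊗ Ψ l)
                           ⊕₂ ((⊝ (half ⊙ (Φ l ⊖ Ψ l))) ⊗ Ψ (unitInv l))))
            × (S (Φ l) ≐ ((half ⊙ (Φ (unitInv l) ⊕ Ψ (unitInv l)))
                          ⊕ (half ⊙ (Φ l ⊖ Ψ l))))
            × (S (Ψ l) ≐ ((half ⊙ (Φ (unitInv l) ⊕ Ψ (unitInv l)))
                          ⊖ (half ⊙ (Φ l ⊖ Ψ l)))))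
       × (∀ (l : Unit) → (ε (Φ l) ≈ 1#) × (ε (Ψ l) ≈ 1#))
       × (ε E ≈ 0#)
       × (S E ≐ (⊝ (Ψ oneU ⋆ E)))
lemma11 R isField charZero _ =
  finiteDual , Δ-closed , S-closed , Δ-E ,
  (λ half half-spec μ → let open Formulas half half-spec in Δ-Φ μ , Δ-Ψ μ , S-Φ μ , S-Ψ μ) ,
  ε-Φ-Ψ , ε-E , S-E
  where
  open HopfSubalgebra R
  open Closure (proj₁ (half-exists isField charZero)) (proj₂ (half-exists isField charZero))
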